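{- Let $S(n,3)$ be the maximal size of a set $A\subseteq\mathbb{F}_3^n$ which does not contain distinct vectors $x,y$ with $\langle x-y,x-y\rangle=0$. For every positive integer $n\equiv 2 \pmod 3$ we have $$S(n,3)= \binom{n+3}{2}-1.$$
   Context: $\langle u,v\rangle=\sum_{i=1}^n u_iv_i$ denotes the standard dot product on $\mathbb{F}_3^n$. -}

module Defs where

open import Data.Nat using (ℕ; zero; suc; _+_; _*_; _≤_; _%_)
open import Data.Fin using (Fin; toℕ)
open import Data.Nat.DivMod using (_mod_)
open import Data.Vec using (Vec; zipWith; foldr)
open import Data.List using (List; length)
open import Data.List.Relation.Unary.Unique.Propositional using (Unique)
open import Data.Product using (_×_; Σ)
open import Relation.Binary.PropositionalEquality using (_≡_)
open import Relation.Nullary using (¬_)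
open import Data.List.Membership.Propositional using (_∈_)

F₃ : Set
F₃ = Fin 3

fromℕ₃ : ℕ → F₃
fromℕ₃ m = m mod 3

_+₃_ : F₃ → F₃ → F₃
a +₃ b = fromℕ₃ (toℕ a + toℕ b)

_*₃_ : F₃ → F₃ → F₃
a *₃ b = fromℕ₃ (toℕ a * toℕ b)

-₃_ : F₃ → F₃
-₃ a = fromℕ₃ (2 * toℕ a)

_-₃_ : F₃ → F₃ → F₃
a -₃ b = a +₃ (-₃ b)

0₃ : F₃
0₃ = fromℕ₃ 0

_-ᵥ_ : ∀ {n} → Vec F₃ n → Vec F₃ n → Vec F₃ n
u -ᵥ v = zipWith _-₃_ u v

⟨_,_⟩ : ∀ {n} → Vec F₃ n → Vec F₃ n → F₃
⟨ u , v ⟩ = foldr (λ _ → F₃) _+₃_ 0₃ (zipWith _*₃_ u v)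

Admissible : (n : ℕ) → List (Vec F₃ n) → Set
Admissible n A =
  Unique A × (∀ x y → x ∈ A → y ∈ A → ¬ (x ≡ y) → ¬ (⟨ x -ᵥ y , x -ᵥ y ⟩ ≡ 0₃))

IsS3 : ℕ → ℕ → Set
IsS3 n m =
  Σ (List (Vec F₃ n)) (λ A → Admissible n A × length A ≡ m)
  × (∀ A → Admissible n A → length A ≤ m)

module Submission where

-- Since ⟨x - y, x - y⟩ = ⟨x,x⟩ + ⟨x,y⟩ + ⟨y,y⟩ over F₃
-- and nonzero squares equal 1, for x in an admissible set A the polynomial
-- f_x(y) = 1 - ⟨x - y, x - y⟩² is 1 at x and 0 at the other points of A.  Every f_x is a
-- combination of the C(n+3,2) - 1 functions ⟨y,y⟩², ⟨y,y⟩ yᵢ, yᵢ yⱼ (i ≤ j), yᵢ and 1, so the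
-- coefficient vectors of the f_x and the value vectors of the points of A form a biorthogonal
-- system in a space of that dimension, and Gaussian elimination bounds |A|.
--
-- For n ≡ 2 (mod 3) the 3n + 2 + C(n,2) = C(n+3,2) - 1 vectors 0, 𝟙, ±eᵢ,
-- -(𝟙 + eᵢ) and 𝟙 + eᵢ + eⱼ (i < j) are admissible: as ⟨𝟙,𝟙⟩ = 2, the squared distance of two
-- of them depends only on their types and on the overlap of their supports, and a finite check
-- shows it vanishes only for equal vectors.

open import Defs
open import Data.Nat using (ℕ; zero; suc; _+_; _*_; _∸_; _%_; _<_; _≤_; z≤n; s≤s)
open import Data.Nat.Properties using (m≤n⇒m≤1+n; +-comm)
open import Data.Nat.Solver using (module +-*-Solver)
open import Data.Nat.Combinatorics using (_C_; nC1≡n; nCk+nC[k+1]≡[n+1]C[k+1])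
open import Data.Fin as Fin using (Fin; zero; suc; _≟_; punchIn; inject₁)
open import Data.Fin.Properties
  using (all?; any?; punchIn-injective; punchInᵢ≢i; <⇒≢; <-irrelevant; <-asym)
open import Data.Vec as Vec using (Vec; []; _∷_; _++_; map; zipWith; head; tail)
open import Data.List as List using (List; []; _∷_; length; allFin; cartesianProduct)
open import Data.List.Properties using (length-++; length-map; length-tabulate)
open import Data.List.Membership.Propositional using (_∈_)
open import Data.List.Membership.Propositional.Properties using (∈-lookup; ∈-map⁻; ∈-++⁻)
open import Data.List.Relation.Binary.Disjoint.Propositional using (Disjoint)
open import Data.List.Relation.Unary.AllPairs using ([]; _∷_)
import Data.List.Relation.Unary.All as All
open import Data.List.Relation.Unary.Unique.Propositional using (Unique)
open import Data.List.Relation.Unary.Unique.Propositional.Properties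
  using (map⁺; ++⁺; allFin⁺; cartesianProduct⁺)
open import Data.Product using (Σ-syntax; _×_; _,_; uncurry)
open import Data.Sum using (inj₁; inj₂)
open import Data.Bool using (if_then_else_)
open import Data.Empty using (⊥-elim)
open import Data.Unit using (tt)
open import Function using (_∘_; id)
open import Relation.Nullary using (Dec; does; yes; no)
open import Relation.Nullary.Decidable using (toWitness; ¬?; _→-dec_; decidable-stable)
open import Relation.Binary.PropositionalEquality
open ≡-Reasoning

private
  variable
    n : ℕ

-- Arithmetic in F₃ and the dot product

1₃ 2₃ : F₃
1₃ = suc zero
2₃ = suc (suc zero)

-- Identities in F₃ are proved by evaluating both sides at every point.
+₃-identityˡ : ∀ a → 0₃ +₃ a ≡ a
+₃-identityˡ = toWitness {a? = all? λ _ → _ ≟ _} tt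

+₃-assoc : ∀ a b c → a +₃ (b +₃ c) ≡ (a +₃ b) +₃ c
+₃-assoc = toWitness {a? = all? λ _ → all? λ _ → all? λ _ → _ ≟ _} tt

*₃-assoc : ∀ a b c → (a *₃ b) *₃ c ≡ a *₃ (b *₃ c)
*₃-assoc = toWitness {a? = all? λ _ → all? λ _ → all? λ _ → _ ≟ _} tt

*₃-identityʳ : ∀ a → a *₃ 1₃ ≡ a
*₃-identityʳ = toWitness {a? = all? λ _ → _ ≟ _} tt

*₃-zeroʳ : ∀ a → a *₃ 0₃ ≡ 0₃
*₃-zeroʳ = toWitness {a? = all? λ _ → _ ≟ _} tt

nonzero-square : ∀ a → a ≢ 0₃ → a *₃ a ≡ 1₃
nonzero-square = toWitness {a? = all? λ _ → ¬? (_ ≟ _) →-dec (_ ≟ _)} tt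

infixl 6 _+ᵥ_
infixr 7 _·ᵥ_

_+ᵥ_ : Vec F₃ n → Vec F₃ n → Vec F₃ n
u +ᵥ v = zipWith _+₃_ u v

_·ᵥ_ : F₃ → Vec F₃ n → Vec F₃ n
a ·ᵥ v = map (a *₃_) v

‖_‖² : Vec F₃ n → F₃
‖ v ‖² = ⟨ v , v ⟩

dot-++ : ∀ {k} (u v : Vec F₃ k) (u′ v′ : Vec F₃ n) →
         ⟨ u ++ u′ , v ++ v′ ⟩ ≡ ⟨ u , v ⟩ +₃ ⟨ u′ , v′ ⟩
dot-++ []      []      u′ v′ = sym (+₃-identityˡ ⟨ u′ , v′ ⟩)
dot-++ (x ∷ u) (y ∷ v) u′ v′ =
  trans (cong ((x *₃ y) +₃_) (dot-++ u v u′ v′)) (+₃-assoc (x *₃ y) ⟨ u , v ⟩ ⟨ u′ , v′ ⟩)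

dot-·ˡ : ∀ a (u v : Vec F₃ n) → ⟨ a ·ᵥ u , v ⟩ ≡ a *₃ ⟨ u , v ⟩
dot-·ˡ a []      []      = sym (*₃-zeroʳ a)
dot-·ˡ a (x ∷ u) (y ∷ v) = trans (cong (((a *₃ x) *₃ y) +₃_) (dot-·ˡ a u v)) (step a x y ⟨ u , v ⟩)
  where
  step : ∀ a x y s → ((a *₃ x) *₃ y) +₃ (a *₃ s) ≡ a *₃ ((x *₃ y) +₃ s)
  step = toWitness {a? = all? λ _ → all? λ _ → all? λ _ → all? λ _ → _ ≟ _} tt

dot-·ʳ : ∀ a (u v : Vec F₃ n) → ⟨ u , a ·ᵥ v ⟩ ≡ a *₃ ⟨ u , v ⟩
dot-·ʳ a []      []      = sym (*₃-zeroʳ a)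
dot-·ʳ a (x ∷ u) (y ∷ v) = trans (cong ((x *₃ (a *₃ y)) +₃_) (dot-·ʳ a u v)) (step a x y ⟨ u , v ⟩)
  where
  step : ∀ a x y s → (x *₃ (a *₃ y)) +₃ (a *₃ s) ≡ a *₃ ((x *₃ y) +₃ s)
  step = toWitness {a? = all? λ _ → all? λ _ → all? λ _ → all? λ _ → _ ≟ _} tt

dot-+ˡ : ∀ (u u′ v : Vec F₃ n) → ⟨ u +ᵥ u′ , v ⟩ ≡ ⟨ u , v ⟩ +₃ ⟨ u′ , v ⟩
dot-+ˡ []      []        []      = refl
dot-+ˡ (x ∷ u) (x′ ∷ u′) (y ∷ v) =
  trans (cong (((x +₃ x′) *₃ y) +₃_) (dot-+ˡ u u′ v)) (step x x′ y ⟨ u , v ⟩ ⟨ u′ , v ⟩)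
  where
  step : ∀ x x′ y s s′ → ((x +₃ x′) *₃ y) +₃ (s +₃ s′) ≡ ((x *₃ y) +₃ s) +₃ ((x′ *₃ y) +₃ s′)
  step = toWitness {a? = all? λ _ → all? λ _ → all? λ _ → all? λ _ → all? λ _ → _ ≟ _} tt

dot-+ʳ : ∀ (u v v′ : Vec F₃ n) → ⟨ u , v +ᵥ v′ ⟩ ≡ ⟨ u , v ⟩ +₃ ⟨ u , v′ ⟩
dot-+ʳ []      []      []        = refl
dot-+ʳ (x ∷ u) (y ∷ v) (y′ ∷ v′) =
  trans (cong ((x *₃ (y +₃ y′)) +₃_) (dot-+ʳ u v v′)) (step x y y′ ⟨ u , v ⟩ ⟨ u , v′ ⟩)
  where
  step : ∀ x y y′ s s′ → (x *₃ (y +₃ y′)) +₃ (s +₃ s′) ≡ ((x *₃ y) +₃ s) +₃ ((x *₃ y′) +₃ s′)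
  step = toWitness {a? = all? λ _ → all? λ _ → all? λ _ → all? λ _ → all? λ _ → _ ≟ _} tt

dot-−ˡ : ∀ (u u′ v : Vec F₃ n) → ⟨ u -ᵥ u′ , v ⟩ ≡ ⟨ u , v ⟩ -₃ ⟨ u′ , v ⟩
dot-−ˡ []      []        []      = refl
dot-−ˡ (x ∷ u) (x′ ∷ u′) (y ∷ v) =
  trans (cong (((x -₃ x′) *₃ y) +₃_) (dot-−ˡ u u′ v)) (step x x′ y ⟨ u , v ⟩ ⟨ u′ , v ⟩)
  where
  step : ∀ x x′ y s s′ → ((x -₃ x′) *₃ y) +₃ (s -₃ s′) ≡ ((x *₃ y) +₃ s) -₃ ((x′ *₃ y) +₃ s′)
  step = toWitness {a? = all? λ _ → all? λ _ → all? λ _ → all? λ _ → all? λ _ → _ ≟ _} tt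

dot-comm : ∀ (u v : Vec F₃ n) → ⟨ u , v ⟩ ≡ ⟨ v , u ⟩
dot-comm []      []      = refl
dot-comm (x ∷ u) (y ∷ v) = cong₂ _+₃_ (*₃-comm x y) (dot-comm u v)
  where
  *₃-comm : ∀ x y → x *₃ y ≡ y *₃ x
  *₃-comm = toWitness {a? = all? λ _ → all? λ _ → _ ≟ _} tt

-- Over F₃ we have -2 = 1, so the cross term appears with coefficient 1.
‖-‖²-expand : ∀ (x y : Vec F₃ n) → ‖ x -ᵥ y ‖² ≡ (‖ x ‖² +₃ ⟨ x , y ⟩) +₃ ‖ y ‖²
‖-‖²-expand []      []      = refl
‖-‖²-expand (a ∷ x) (b ∷ y) =
  trans (cong (((a -₃ b) *₃ (a -₃ b)) +₃_) (‖-‖²-expand x y)) (step a b ‖ x ‖² ⟨ x , y ⟩ ‖ y ‖²)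
  where
  step : ∀ a b p l r → ((a -₃ b) *₃ (a -₃ b)) +₃ ((p +₃ l) +₃ r)
                     ≡ (((a *₃ a) +₃ p) +₃ ((a *₃ b) +₃ l)) +₃ ((b *₃ b) +₃ r)
  step = toWitness {a? = all? λ _ → all? λ _ → all? λ _ → all? λ _ → all? λ _ → _ ≟ _} tt

‖x-x‖²≡0 : ∀ (x : Vec F₃ n) → ‖ x -ᵥ x ‖² ≡ 0₃
‖x-x‖²≡0 x = trans (‖-‖²-expand x x) (a+a+a≡0 ‖ x ‖²)
  where
  a+a+a≡0 : ∀ a → (a +₃ a) +₃ a ≡ 0₃
  a+a+a≡0 = toWitness {a? = all? λ _ → _ ≟ _} tt

‖-‖²-comm : ∀ (x y : Vec F₃ n) → ‖ x -ᵥ y ‖² ≡ ‖ y -ᵥ x ‖²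
‖-‖²-comm x y = begin
  ‖ x -ᵥ y ‖²                        ≡⟨ ‖-‖²-expand x y ⟩
  (‖ x ‖² +₃ ⟨ x , y ⟩) +₃ ‖ y ‖²    ≡⟨ cong (λ t → (‖ x ‖² +₃ t) +₃ ‖ y ‖²) (dot-comm x y) ⟩
  (‖ x ‖² +₃ ⟨ y , x ⟩) +₃ ‖ y ‖²    ≡⟨ swap ‖ x ‖² ⟨ y , x ⟩ ‖ y ‖² ⟩
  (‖ y ‖² +₃ ⟨ y , x ⟩) +₃ ‖ x ‖²    ≡⟨ ‖-‖²-expand y x ⟨
  ‖ y -ᵥ x ‖²                        ∎
  where
  swap : ∀ a b c → (a +₃ b) +₃ c ≡ (c +₃ b) +₃ a
  swap = toWitness {a? = all? λ _ → all? λ _ → all? λ _ → _ ≟ _} tt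

-- Biorthogonal families

record Biorthogonal {m d} (c g : Fin m → Vec F₃ d) : Set where
  field
    diagonal     : ∀ i → ⟨ c i , g i ⟩ ≡ 1₃
    off-diagonal : ∀ {i j} → i ≢ j → ⟨ c i , g j ⟩ ≡ 0₃

open Biorthogonal

dot-[] : (u v : Vec F₃ 0) → ⟨ u , v ⟩ ≡ 0₃
dot-[] [] [] = refl

dot-tail : ∀ (u v : Vec F₃ (suc n)) → head u ≡ 0₃ → ⟨ tail u , tail v ⟩ ≡ ⟨ u , v ⟩
dot-tail (x ∷ u) (y ∷ v) refl = sym (+₃-identityˡ ⟨ u , v ⟩)

head-−· : ∀ (u v : Vec F₃ (suc n)) a → head (u -ᵥ (a ·ᵥ v)) ≡ head u -₃ (a *₃ head v)
head-−· (x ∷ u) (y ∷ v) a = refl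

biorthogonal-tail : ∀ {m d} {c g : Fin m → Vec F₃ (suc d)} → Biorthogonal c g →
                    (∀ i → head (c i) ≡ 0₃) → Biorthogonal (tail ∘ c) (tail ∘ g)
biorthogonal-tail {c = c} {g} bo c₀ = record
  { diagonal     = λ i → trans (dot-tail (c i) (g i) (c₀ i)) (diagonal bo i)
  ; off-diagonal = λ {i} {j} i≢j → trans (dot-tail (c i) (g j) (c₀ i)) (off-diagonal bo i≢j)
  }

module Elimination {m d} {c g : Fin (suc m) → Vec F₃ (suc d)} (bo : Biorthogonal c g)
                   (p : Fin (suc m)) (pivot≢0 : head (c p) ≢ 0₃) where

  ratio : Fin m → F₃
  ratio i = head (c (punchIn p i)) *₃ head (c p)

  reduced : Fin m → Vec F₃ (suc d)
  reduced i = c (punchIn p i) -ᵥ (ratio i ·ᵥ c p)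

  reduced-head : ∀ i → head (reduced i) ≡ 0₃
  reduced-head i = begin
    head (reduced i)        ≡⟨ head-−· (c (punchIn p i)) (c p) (ratio i) ⟩
    a -₃ ((a *₃ t) *₃ t)    ≡⟨ cong (_-₃_ a) (*₃-assoc a t t) ⟩
    a -₃ (a *₃ (t *₃ t))    ≡⟨ cong (λ s → a -₃ (a *₃ s)) (nonzero-square t pivot≢0) ⟩
    a -₃ (a *₃ 1₃)          ≡⟨ cong (_-₃_ a) (*₃-identityʳ a) ⟩
    a -₃ a                  ≡⟨ a-a≡0 a ⟩
    0₃                      ∎
    where
    a = head (c (punchIn p i))
    t = head (c p)
    a-a≡0 : ∀ a → a -₃ a ≡ 0₃
    a-a≡0 = toWitness {a? = all? λ _ → _ ≟ _} tt

  -- Row p is orthogonal to every g j with j ≠ p, so subtracting its multiples does not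
  -- change the products with those g j.
  reduced-dot : ∀ i j → ⟨ tail (reduced i) , tail (g (punchIn p j)) ⟩ ≡ ⟨ c (punchIn p i) , g (punchIn p j) ⟩
  reduced-dot i j = begin
    ⟨ tail (reduced i) , tail gⱼ ⟩           ≡⟨ dot-tail (reduced i) gⱼ (reduced-head i) ⟩
    ⟨ reduced i , gⱼ ⟩                       ≡⟨ dot-−ˡ (c (punchIn p i)) (ratio i ·ᵥ c p) gⱼ ⟩
    l -₃ ⟨ ratio i ·ᵥ c p , gⱼ ⟩             ≡⟨ cong (_-₃_ l) (dot-·ˡ (ratio i) (c p) gⱼ) ⟩
    l -₃ (ratio i *₃ ⟨ c p , gⱼ ⟩)           ≡⟨ cong (λ s → l -₃ (ratio i *₃ s)) p⊥gⱼ ⟩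
    l -₃ (ratio i *₃ 0₃)                     ≡⟨ l-r·0≡l l (ratio i) ⟩
    l                                        ∎
    where
    gⱼ = g (punchIn p j)
    l = ⟨ c (punchIn p i) , gⱼ ⟩
    p⊥gⱼ : ⟨ c p , gⱼ ⟩ ≡ 0₃
    p⊥gⱼ = off-diagonal bo (punchInᵢ≢i p j ∘ sym)
    l-r·0≡l : ∀ l r → l -₃ (r *₃ 0₃) ≡ l
    l-r·0≡l = toWitness {a? = all? λ _ → all? λ _ → _ ≟ _} tt

  biorthogonal-reduced : Biorthogonal (tail ∘ reduced) (λ j → tail (g (punchIn p j)))
  biorthogonal-reduced = record
    { diagonal     = λ i → trans (reduced-dot i i) (diagonal bo (punchIn p i))
    ; off-diagonal = λ {i} {j} i≢j → trans (reduced-dot i j) (off-diagonal bo (i≢j ∘ punchIn-injective p i j))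
    }

biorthogonal⇒≤ : ∀ {m d} {c g : Fin m → Vec F₃ d} → Biorthogonal c g → m ≤ d
biorthogonal⇒≤ {zero}          _  = z≤n
biorthogonal⇒≤ {suc m} {zero} {c} {g} bo with trans (sym (diagonal bo zero)) (dot-[] (c zero) (g zero))
... | ()
biorthogonal⇒≤ {suc m} {suc d} {c} bo with any? (λ i → ¬? (head (c i) ≟ 0₃))
... | yes (p , pivot≢0) = s≤s (biorthogonal⇒≤ (Elimination.biorthogonal-reduced bo p pivot≢0))
... | no no-pivot       = m≤n⇒m≤1+n (biorthogonal⇒≤ (biorthogonal-tail bo λ i →
                            decidable-stable (head (c i) ≟ 0₃) (no-pivot ∘ (i ,_))))

-- The upper bound: the polynomial method

triangular : ℕ → ℕ
triangular zero    = zero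
triangular (suc n) = suc (n + triangular n)

quadratics : Vec F₃ n → Vec F₃ (triangular n)
quadratics []      = []
quadratics (a ∷ y) = a *₃ a ∷ a ·ᵥ y ++ quadratics y

quadratic-coefficients : F₃ → Vec F₃ n → Vec F₃ (triangular n)
quadratic-coefficients c []      = []
quadratic-coefficients c (b ∷ x) = (2₃ *₃ (b *₃ b)) +₃ c ∷ b ·ᵥ x ++ quadratic-coefficients c x

dot-quadratics : ∀ c (x y : Vec F₃ n) →
  ⟨ quadratic-coefficients c x , quadratics y ⟩ ≡ (2₃ *₃ (⟨ x , y ⟩ *₃ ⟨ x , y ⟩)) +₃ (c *₃ ‖ y ‖²)
dot-quadratics c [] [] = sym (vanish c)
  where
  vanish : ∀ c → (2₃ *₃ (0₃ *₃ 0₃)) +₃ (c *₃ 0₃) ≡ 0₃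
  vanish = toWitness {a? = all? λ _ → _ ≟ _} tt
dot-quadratics c (b ∷ x) (a ∷ y) = begin
  h +₃ ⟨ b ·ᵥ x ++ quadratic-coefficients c x , a ·ᵥ y ++ quadratics y ⟩
    ≡⟨ cong (h +₃_) (dot-++ (b ·ᵥ x) (a ·ᵥ y) (quadratic-coefficients c x) (quadratics y)) ⟩
  h +₃ (⟨ b ·ᵥ x , a ·ᵥ y ⟩ +₃ ⟨ quadratic-coefficients c x , quadratics y ⟩)
    ≡⟨ cong (h +₃_) (cong₂ _+₃_ mixed (dot-quadratics c x y)) ⟩
  h +₃ ((b *₃ (a *₃ l)) +₃ ((2₃ *₃ (l *₃ l)) +₃ (c *₃ q)))
    ≡⟨ step a b c l q ⟩
  (2₃ *₃ (((b *₃ a) +₃ l) *₃ ((b *₃ a) +₃ l))) +₃ (c *₃ ((a *₃ a) +₃ q))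
    ∎
  where
  h = ((2₃ *₃ (b *₃ b)) +₃ c) *₃ (a *₃ a)
  l = ⟨ x , y ⟩
  q = ‖ y ‖²
  mixed : ⟨ b ·ᵥ x , a ·ᵥ y ⟩ ≡ b *₃ (a *₃ l)
  mixed = trans (dot-·ˡ b x (a ·ᵥ y)) (cong (b *₃_) (dot-·ʳ a x y))
  step : ∀ a b c l q →
    (((2₃ *₃ (b *₃ b)) +₃ c) *₃ (a *₃ a)) +₃ ((b *₃ (a *₃ l)) +₃ ((2₃ *₃ (l *₃ l)) +₃ (c *₃ q)))
      ≡ (2₃ *₃ (((b *₃ a) +₃ l) *₃ ((b *₃ a) +₃ l))) +₃ (c *₃ ((a *₃ a) +₃ q))
  step = toWitness {a? = all? λ _ → all? λ _ → all? λ _ → all? λ _ → all? λ _ → _ ≟ _} tt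

featureDim : ℕ → ℕ
featureDim n = suc (n + (triangular n + (n + 1)))

monomials : Vec F₃ n → Vec F₃ (featureDim n)
monomials y = q *₃ q ∷ q ·ᵥ y ++ quadratics y ++ y ++ 1₃ ∷ []
  where q = ‖ y ‖²

coefficients : Vec F₃ n → Vec F₃ (featureDim n)
coefficients x = 2₃ ∷ x ++ quadratic-coefficients c x ++ c ·ᵥ x ++ 1₃ -₃ (c *₃ c) ∷ []
  where c = ‖ x ‖²

coefficients-dot-monomials : ∀ (x y : Vec F₃ n) →
  ⟨ coefficients x , monomials y ⟩ ≡ 1₃ -₃ (‖ x -ᵥ y ‖² *₃ ‖ x -ᵥ y ‖²)
coefficients-dot-monomials x y = begin
  (2₃ *₃ (q *₃ q)) +₃ ⟨ x ++ quadratic-coefficients c x ++ c ·ᵥ x ++ k ∷ [] , q ·ᵥ y ++ quadratics y ++ y ++ 1₃ ∷ [] ⟩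
    ≡⟨ cong ((2₃ *₃ (q *₃ q)) +₃_) blocks ⟩
  (2₃ *₃ (q *₃ q)) +₃ ((q *₃ l) +₃ (((2₃ *₃ (l *₃ l)) +₃ (c *₃ q)) +₃ ((c *₃ l) +₃ ((k *₃ 1₃) +₃ 0₃))))
    ≡⟨ expand q l c ⟩
  1₃ -₃ (((c +₃ l) +₃ q) *₃ ((c +₃ l) +₃ q))
    ≡⟨ cong (λ d → 1₃ -₃ (d *₃ d)) (sym (‖-‖²-expand x y)) ⟩
  1₃ -₃ (‖ x -ᵥ y ‖² *₃ ‖ x -ᵥ y ‖²)
    ∎
  where
  c = ‖ x ‖²
  q = ‖ y ‖²
  l = ⟨ x , y ⟩
  k = 1₃ -₃ (c *₃ c)
  linear : ⟨ c ·ᵥ x ++ k ∷ [] , y ++ 1₃ ∷ [] ⟩ ≡ (c *₃ l) +₃ ((k *₃ 1₃) +₃ 0₃)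
  linear = trans (dot-++ (c ·ᵥ x) y (k ∷ []) (1₃ ∷ [])) (cong (_+₃ ((k *₃ 1₃) +₃ 0₃)) (dot-·ˡ c x y))
  quadratic : ⟨ quadratic-coefficients c x ++ c ·ᵥ x ++ k ∷ [] , quadratics y ++ y ++ 1₃ ∷ [] ⟩
              ≡ ((2₃ *₃ (l *₃ l)) +₃ (c *₃ q)) +₃ ((c *₃ l) +₃ ((k *₃ 1₃) +₃ 0₃))
  quadratic = trans (dot-++ (quadratic-coefficients c x) (quadratics y) (c ·ᵥ x ++ k ∷ []) (y ++ 1₃ ∷ []))
                    (cong₂ _+₃_ (dot-quadratics c x y) linear)
  blocks : ⟨ x ++ quadratic-coefficients c x ++ c ·ᵥ x ++ k ∷ [] , q ·ᵥ y ++ quadratics y ++ y ++ 1₃ ∷ [] ⟩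
           ≡ (q *₃ l) +₃ (((2₃ *₃ (l *₃ l)) +₃ (c *₃ q)) +₃ ((c *₃ l) +₃ ((k *₃ 1₃) +₃ 0₃)))
  blocks = trans (dot-++ x (q ·ᵥ y) (quadratic-coefficients c x ++ c ·ᵥ x ++ k ∷ []) (quadratics y ++ y ++ 1₃ ∷ []))
                 (cong₂ _+₃_ (dot-·ʳ q x y) quadratic)
  expand : ∀ q l c →
    (2₃ *₃ (q *₃ q)) +₃ ((q *₃ l) +₃ (((2₃ *₃ (l *₃ l)) +₃ (c *₃ q)) +₃ ((c *₃ l) +₃ (((1₃ -₃ (c *₃ c)) *₃ 1₃) +₃ 0₃))))
      ≡ 1₃ -₃ (((c +₃ l) +₃ q) *₃ ((c +₃ l) +₃ q))
  expand = toWitness {a? = all? λ _ → all? λ _ → all? λ _ → _ ≟ _} tt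

lookup-injective : ∀ {A : Set} {xs : List A} → Unique xs → ∀ {i j} → i ≢ j → List.lookup xs i ≢ List.lookup xs j
lookup-injective (_  ∷ _)      {zero}  {zero}  i≢j = ⊥-elim (i≢j refl)
lookup-injective (x∉ ∷ _)      {zero}  {suc j} _   = All.lookup x∉ (∈-lookup j)
lookup-injective (x∉ ∷ _)      {suc i} {zero}  _   = All.lookup x∉ (∈-lookup i) ∘ sym
lookup-injective (_  ∷ unique) {suc i} {suc j} i≢j = lookup-injective unique (i≢j ∘ cong suc)

admissible⇒length≤featureDim : ∀ A → Admissible n A → length A ≤ featureDim n
admissible⇒length≤featureDim A (unique , separated) =
  biorthogonal⇒≤ {c = coefficients ∘ at} {g = monomials ∘ at} record
    { diagonal     = λ i → trans (coefficients-dot-monomials (at i) (at i))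
                                  (cong (λ d → 1₃ -₃ (d *₃ d)) (‖x-x‖²≡0 (at i)))
    ; off-diagonal = λ {i} {j} i≢j → trans (coefficients-dot-monomials (at i) (at j))
                       (1-d²≡0 _ (separated _ _ (∈-lookup i) (∈-lookup j) (lookup-injective unique i≢j)))
    }
  where
  at = List.lookup A
  1-d²≡0 : ∀ d → d ≢ 0₃ → 1₃ -₃ (d *₃ d) ≡ 0₃
  1-d²≡0 = toWitness {a? = all? λ _ → ¬? (_ ≟ _) →-dec (_ ≟ _)} tt

-- The lower bound: the construction

𝟘 𝟙 : Vec F₃ n
𝟘 {zero}  = []
𝟘 {suc n} = 0₃ ∷ 𝟘
𝟙 {zero}  = []
𝟙 {suc n} = 1₃ ∷ 𝟙

e : Fin n → Vec F₃ n
e zero    = 1₃ ∷ 𝟘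
e (suc i) = 0₃ ∷ e i

δ : ∀ {A : Set} → Dec A → F₃
δ a? = if does a? then 1₃ else 0₃

lookup-𝟘 : ∀ (i : Fin n) → Vec.lookup 𝟘 i ≡ 0₃
lookup-𝟘 zero    = refl
lookup-𝟘 (suc i) = lookup-𝟘 i

lookup-𝟙 : ∀ (i : Fin n) → Vec.lookup 𝟙 i ≡ 1₃
lookup-𝟙 zero    = refl
lookup-𝟙 (suc i) = lookup-𝟙 i

lookup-e : ∀ (i k : Fin n) → Vec.lookup (e k) i ≡ δ (i ≟ k)
lookup-e zero    zero    = refl
lookup-e zero    (suc k) = refl
lookup-e (suc i) zero    = lookup-𝟘 i
lookup-e (suc i) (suc k) = lookup-e i k

dot-𝟘ˡ : ∀ (v : Vec F₃ n) → ⟨ 𝟘 , v ⟩ ≡ 0₃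
dot-𝟘ˡ []      = refl
dot-𝟘ˡ (y ∷ v) = cong (0₃ +₃_) (dot-𝟘ˡ v)

dot-eˡ : ∀ (i : Fin n) v → ⟨ e i , v ⟩ ≡ Vec.lookup v i
dot-eˡ zero    (y ∷ v) = trans (cong ((1₃ *₃ y) +₃_) (dot-𝟘ˡ v)) (1·y+0≡y y)
  where
  1·y+0≡y : ∀ y → (1₃ *₃ y) +₃ 0₃ ≡ y
  1·y+0≡y = toWitness {a? = all? λ _ → _ ≟ _} tt
dot-eˡ (suc i) (y ∷ v) = trans (+₃-identityˡ ⟨ e i , v ⟩) (dot-eˡ i v)

e-dot-e : ∀ (i k : Fin n) → ⟨ e i , e k ⟩ ≡ δ (i ≟ k)
e-dot-e i k = trans (dot-eˡ i (e k)) (lookup-e i k)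

e-dot-e-same : ∀ (i : Fin n) → ⟨ e i , e i ⟩ ≡ 1₃
e-dot-e-same i with i ≟ i | e-dot-e i i
... | yes _  | eq = eq
... | no i≢i | _  = ⊥-elim (i≢i refl)

e-dot-e-apart : ∀ {i k : Fin n} → i ≢ k → ⟨ e i , e k ⟩ ≡ 0₃
e-dot-e-apart {i = i} {k} i≢k with i ≟ k | e-dot-e i k
... | yes i≡k | _  = ⊥-elim (i≢k i≡k)
... | no _    | eq = eq

e-dot-pair : ∀ (i k l : Fin n) → ⟨ e i , e k +ᵥ e l ⟩ ≡ δ (i ≟ k) +₃ δ (i ≟ l)
e-dot-pair i k l = trans (dot-+ʳ (e i) (e k) (e l)) (cong₂ _+₃_ (e-dot-e i k) (e-dot-e i l))

e-dot-pair≢2 : ∀ (i : Fin n) {k l} → k ≢ l → ⟨ e i , e k +ᵥ e l ⟩ ≢ 2₃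
e-dot-pair≢2 i {k} {l} k≢l h = count (i ≟ k) (i ≟ l) (trans (sym (e-dot-pair i k l)) h)
  where
  count : (ik : Dec (i ≡ k)) (il : Dec (i ≡ l)) → δ ik +₃ δ il ≢ 2₃
  count (yes i≡k) (yes i≡l) _ = k≢l (trans (sym i≡k) i≡l)
  count (yes _)   (no _)    ()
  count (no _)    (yes _)   ()
  count (no _)    (no _)    ()

pair-overlap≡2⇒≡ : ∀ {i j k l : Fin n} → i Fin.< j → k Fin.< l →
                   ⟨ e i +ᵥ e j , e k +ᵥ e l ⟩ ≡ 2₃ → i ≡ k × j ≡ l
pair-overlap≡2⇒≡ {i = i} {j} {k} {l} i<j k<l h =
  count (i ≟ k) (i ≟ l) (j ≟ k) (j ≟ l) (trans (sym expand) h)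
  where
  expand : ⟨ e i +ᵥ e j , e k +ᵥ e l ⟩ ≡ (δ (i ≟ k) +₃ δ (i ≟ l)) +₃ (δ (j ≟ k) +₃ δ (j ≟ l))
  expand = trans (dot-+ˡ (e i) (e j) (e k +ᵥ e l)) (cong₂ _+₃_ (e-dot-pair i k l) (e-dot-pair j k l))
  count : (ik : Dec (i ≡ k)) (il : Dec (i ≡ l)) (jk : Dec (j ≡ k)) (jl : Dec (j ≡ l)) →
          (δ ik +₃ δ il) +₃ (δ jk +₃ δ jl) ≡ 2₃ → i ≡ k × j ≡ l
  count (yes i≡k) _         _         (yes j≡l) _ = i≡k , j≡l
  count (yes i≡k) (yes i≡l) _         _         _ = ⊥-elim (<⇒≢ k<l (trans (sym i≡k) i≡l))
  count (yes i≡k) _         (yes j≡k) _         _ = ⊥-elim (<⇒≢ i<j (trans i≡k (sym j≡k)))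
  count _         (yes i≡l) _         (yes j≡l) _ = ⊥-elim (<⇒≢ i<j (trans i≡l (sym j≡l)))
  count _         _         (yes j≡k) (yes j≡l) _ = ⊥-elim (<⇒≢ k<l (trans (sym j≡k) j≡l))
  count _         (yes i≡l) (yes j≡k) _         _ = ⊥-elim (<-asym i<j (subst₂ Fin._<_ (sym j≡k) (sym i≡l) k<l))
  count (yes _)   (no _)    (no _)    (no _)    ()
  count (no _)    (yes _)   (no _)    (no _)    ()
  count (no _)    (no _)    (yes _)   (no _)    ()
  count (no _)    (no _)    (no _)    (yes _)   ()
  count (no _)    (no _)    (no _)    (no _)    ()

𝟙-dot-e : ∀ (i : Fin n) → ⟨ 𝟙 , e i ⟩ ≡ 1₃
𝟙-dot-e i = trans (dot-comm 𝟙 (e i)) (trans (dot-eˡ i 𝟙) (lookup-𝟙 i))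

‖𝟙‖²≡2 : n % 3 ≡ 2 → ‖ 𝟙 {n} ‖² ≡ 2₃
‖𝟙‖²≡2 {2}                   _     = refl
‖𝟙‖²≡2 {suc (suc (suc n))} n%3≡2 = trans (three-ones ‖ 𝟙 {n} ‖²) (‖𝟙‖²≡2 {n} n%3≡2)
  where
  three-ones : ∀ s → (1₃ *₃ 1₃) +₃ ((1₃ *₃ 1₃) +₃ ((1₃ *₃ 1₃) +₃ s)) ≡ s
  three-ones = toWitness {a? = all? λ _ → _ ≟ _} tt

dot-affine : ∀ a b (w u v : Vec F₃ n) →
  ⟨ a ·ᵥ w +ᵥ u , b ·ᵥ w +ᵥ v ⟩
    ≡ ((a *₃ (b *₃ ‖ w ‖²)) +₃ (a *₃ ⟨ w , v ⟩)) +₃ ((b *₃ ⟨ u , w ⟩) +₃ ⟨ u , v ⟩)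
dot-affine a b w u v = begin
  ⟨ a ·ᵥ w +ᵥ u , b ·ᵥ w +ᵥ v ⟩
    ≡⟨ dot-+ˡ (a ·ᵥ w) u (b ·ᵥ w +ᵥ v) ⟩
  ⟨ a ·ᵥ w , b ·ᵥ w +ᵥ v ⟩ +₃ ⟨ u , b ·ᵥ w +ᵥ v ⟩
    ≡⟨ cong₂ _+₃_ (dot-+ʳ (a ·ᵥ w) (b ·ᵥ w) v) (dot-+ʳ u (b ·ᵥ w) v) ⟩
  (⟨ a ·ᵥ w , b ·ᵥ w ⟩ +₃ ⟨ a ·ᵥ w , v ⟩) +₃ (⟨ u , b ·ᵥ w ⟩ +₃ ⟨ u , v ⟩)
    ≡⟨ cong₂ _+₃_ (cong₂ _+₃_ (trans (dot-·ˡ a w (b ·ᵥ w)) (cong (a *₃_) (dot-·ʳ b w w))) (dot-·ˡ a w v))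
                  (cong (_+₃ ⟨ u , v ⟩) (dot-·ʳ b u w)) ⟩
  ((a *₃ (b *₃ ‖ w ‖²)) +₃ (a *₃ ⟨ w , v ⟩)) +₃ ((b *₃ ⟨ u , w ⟩) +₃ ⟨ u , v ⟩)
    ∎

Pair : ℕ → Set
Pair n = Σ[ i ∈ Fin n ] Σ[ j ∈ Fin n ] i Fin.< j

-- point (flat a) = a·𝟙 for a = 0, 1;  point (spike s i) is e i, -e i or -(𝟙 + e i);
-- point (pair (i , j , _)) = 𝟙 + e i + e j.
data Code (n : ℕ) : Set where
  flat  : Fin 2 → Code n
  spike : Fin 3 → Fin n → Code n
  pair  : Pair n → Code n

spike-level spike-height : Fin 3 → F₃
spike-level zero          = 0₃
spike-level (suc zero)    = 0₃
spike-level (suc (suc _)) = 2₃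
spike-height zero    = 1₃
spike-height (suc _) = 2₃

level : Code n → F₃
level (flat a)    = inject₁ a
level (spike s _) = spike-level s
level (pair _)    = 1₃

offset : Code n → Vec F₃ n
offset (flat _)           = 𝟘
offset (spike s i)        = spike-height s ·ᵥ e i
offset (pair (i , j , _)) = e i +ᵥ e j

point : Code n → Vec F₃ n
point c = level c ·ᵥ 𝟙 +ᵥ offset c

weight : Code n → F₃
weight (flat _)    = 0₃
weight (spike s _) = spike-height s
weight (pair _)    = 2₃

energy : Code n → F₃
energy (flat _)    = 0₃
energy (spike s _) = spike-height s *₃ spike-height s
energy (pair _)    = 2₃

𝟙-dot-offset : ∀ (c : Code n) → ⟨ 𝟙 , offset c ⟩ ≡ weight c
𝟙-dot-offset {n} (flat _)         = trans (dot-comm {n} 𝟙 𝟘) (dot-𝟘ˡ (𝟙 {n}))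
𝟙-dot-offset (spike s i)          = trans (dot-·ʳ (spike-height s) 𝟙 (e i))
  (trans (cong (spike-height s *₃_) (𝟙-dot-e i)) (*₃-identityʳ (spike-height s)))
𝟙-dot-offset (pair (i , j , _))   = trans (dot-+ʳ 𝟙 (e i) (e j)) (cong₂ _+₃_ (𝟙-dot-e i) (𝟙-dot-e j))

‖offset‖² : ∀ (c : Code n) → ‖ offset c ‖² ≡ energy c
‖offset‖² {n} (flat _) = dot-𝟘ˡ (𝟘 {n})
‖offset‖² (spike s i) = begin
  ⟨ h ·ᵥ e i , h ·ᵥ e i ⟩   ≡⟨ dot-·ˡ h (e i) (h ·ᵥ e i) ⟩
  h *₃ ⟨ e i , h ·ᵥ e i ⟩   ≡⟨ cong (h *₃_) (dot-·ʳ h (e i) (e i)) ⟩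
  h *₃ (h *₃ ⟨ e i , e i ⟩) ≡⟨ cong (λ t → h *₃ (h *₃ t)) (e-dot-e-same i) ⟩
  h *₃ (h *₃ 1₃)            ≡⟨ cong (h *₃_) (*₃-identityʳ h) ⟩
  h *₃ h                    ∎
  where h = spike-height s
‖offset‖² (pair (i , j , i<j)) = begin
  ⟨ e i +ᵥ e j , e i +ᵥ e j ⟩
    ≡⟨ dot-+ˡ (e i) (e j) (e i +ᵥ e j) ⟩
  ⟨ e i , e i +ᵥ e j ⟩ +₃ ⟨ e j , e i +ᵥ e j ⟩
    ≡⟨ cong₂ _+₃_ (dot-+ʳ (e i) (e i) (e j)) (dot-+ʳ (e j) (e i) (e j)) ⟩
  (⟨ e i , e i ⟩ +₃ ⟨ e i , e j ⟩) +₃ (⟨ e j , e i ⟩ +₃ ⟨ e j , e j ⟩)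
    ≡⟨ cong₂ _+₃_ (cong₂ _+₃_ (e-dot-e-same i) (e-dot-e-apart (<⇒≢ i<j)))
                  (cong₂ _+₃_ (e-dot-e-apart (<⇒≢ i<j ∘ sym)) (e-dot-e-same j)) ⟩
  (1₃ +₃ 0₃) +₃ (0₃ +₃ 1₃)
    ∎

-- Besides the overlap o = ⟨ offset c , offset d ⟩, these depend only on the constructors and
-- shapes, never on the indices, which makes the case checks below finite.
dot-form : Code n → Code n → F₃ → F₃
dot-form c d o = ((level c *₃ (level d *₃ 2₃)) +₃ (level c *₃ weight d)) +₃ ((level d *₃ weight c) +₃ o)

dist-form : Code n → Code n → F₃ → F₃
dist-form c d o = (dot-form c c (energy c) +₃ dot-form c d o) +₃ dot-form d d (energy d)

module _ {n} (‖𝟙‖²≡2 : ‖ 𝟙 {n} ‖² ≡ 2₃) where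

  dot-point : ∀ (c d : Code n) → ⟨ point c , point d ⟩ ≡ dot-form c d ⟨ offset c , offset d ⟩
  dot-point c d = begin
    ⟨ point c , point d ⟩
      ≡⟨ dot-affine (level c) (level d) 𝟙 (offset c) (offset d) ⟩
    ((level c *₃ (level d *₃ ‖ 𝟙 {n} ‖²)) +₃ (level c *₃ ⟨ 𝟙 , offset d ⟩)) +₃ ((level d *₃ ⟨ offset c , 𝟙 ⟩) +₃ o)
      ≡⟨ cong₂ (λ s t → ((level c *₃ (level d *₃ s)) +₃ (level c *₃ t)) +₃ ((level d *₃ ⟨ offset c , 𝟙 ⟩) +₃ o))
               ‖𝟙‖²≡2 (𝟙-dot-offset d) ⟩
    ((level c *₃ (level d *₃ 2₃)) +₃ (level c *₃ weight d)) +₃ ((level d *₃ ⟨ offset c , 𝟙 ⟩) +₃ o)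
      ≡⟨ cong (λ t → ((level c *₃ (level d *₃ 2₃)) +₃ (level c *₃ weight d)) +₃ ((level d *₃ t) +₃ o))
              (trans (dot-comm (offset c) 𝟙) (𝟙-dot-offset c)) ⟩
    dot-form c d o
      ∎
    where o = ⟨ offset c , offset d ⟩

  dist-point : ∀ (c d : Code n) → ‖ point c -ᵥ point d ‖² ≡ dist-form c d ⟨ offset c , offset d ⟩
  dist-point c d = trans (‖-‖²-expand (point c) (point d))
    (cong₂ _+₃_ (cong₂ _+₃_ (norm c) (dot-point c d)) (norm d))
    where
    norm : ∀ c → ‖ point c ‖² ≡ dot-form c c (energy c)
    norm c = trans (dot-point c c) (cong (dot-form c c) (‖offset‖² c))

  private
    dist-form≡0 : ∀ (c d : Code n) {o} → ⟨ offset c , offset d ⟩ ≡ o →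
                  ‖ point c -ᵥ point d ‖² ≡ 0₃ → dist-form c d o ≡ 0₃
    dist-form≡0 c d refl h = trans (sym (dist-point c d)) h

    flat-flat : ∀ a b → dist-form {n} (flat a) (flat b) 0₃ ≡ 0₃ → a ≡ b
    flat-flat = toWitness {a? = all? λ _ → all? λ _ → (_ ≟ _) →-dec (_ ≟ _)} tt

    flat-spike : ∀ k a s → dist-form {n} (flat a) (spike s k) 0₃ ≢ 0₃
    flat-spike k = toWitness {a? = all? λ _ → all? λ _ → ¬? (_ ≟ _)} tt

    flat-pair : ∀ p a → dist-form {n} (flat a) (pair p) 0₃ ≢ 0₃
    flat-pair p = toWitness {a? = all? λ _ → ¬? (_ ≟ _)} tt

    spike-spike-same : ∀ i s t →
      dist-form {n} (spike s i) (spike t i) (spike-height s *₃ (spike-height t *₃ 1₃)) ≡ 0₃ → s ≡ t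
    spike-spike-same i = toWitness {a? = all? λ _ → all? λ _ → (_ ≟ _) →-dec (_ ≟ _)} tt

    spike-spike-apart : ∀ i k s t →
      dist-form {n} (spike s i) (spike t k) (spike-height s *₃ (spike-height t *₃ 0₃)) ≢ 0₃
    spike-spike-apart i k = toWitness {a? = all? λ _ → all? λ _ → ¬? (_ ≟ _)} tt

    spike-pair : ∀ i p s o → o ≢ 2₃ → dist-form {n} (spike s i) (pair p) (spike-height s *₃ o) ≢ 0₃
    spike-pair i p = toWitness {a? = all? λ _ → all? λ _ → ¬? (_ ≟ _) →-dec ¬? (_ ≟ _)} tt

    pair-pair : ∀ p q o → dist-form {n} (pair p) (pair q) o ≡ 0₃ → o ≡ 2₃
    pair-pair p q = toWitness {a? = all? λ _ → (_ ≟ _) →-dec (_ ≟ _)} tt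

    flat-separated : ∀ a (d : Code n) → ‖ point (flat a) -ᵥ point d ‖² ≡ 0₃ → flat a ≡ d
    flat-separated a d h with d | dist-form≡0 (flat a) d (dot-𝟘ˡ (offset d)) h
    ... | flat b    | h′ = cong flat (flat-flat a b h′)
    ... | spike s k | h′ = ⊥-elim (flat-spike k a s h′)
    ... | pair p    | h′ = ⊥-elim (flat-pair p a h′)

    spike-dot-spike : ∀ s t (i k : Fin n) →
      ⟨ spike-height s ·ᵥ e i , spike-height t ·ᵥ e k ⟩ ≡ spike-height s *₃ (spike-height t *₃ δ (i ≟ k))
    spike-dot-spike s t i k =
      trans (dot-·ˡ (spike-height s) (e i) (spike-height t ·ᵥ e k))
            (cong (spike-height s *₃_) (trans (dot-·ʳ (spike-height t) (e i) (e k))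
                                              (cong (spike-height t *₃_) (e-dot-e i k))))

    spike-separated : ∀ s t (i k : Fin n) →
      ‖ point (spike s i) -ᵥ point (spike t k) ‖² ≡ 0₃ → spike s i ≡ spike t k
    spike-separated s t i k h with i ≟ k | dist-form≡0 (spike s i) (spike t k) (spike-dot-spike s t i k) h
    ... | no _     | h′ = ⊥-elim (spike-spike-apart i k s t h′)
    ... | yes refl | h′ = cong (λ s → spike s i) (spike-spike-same i s t h′)

    spike-pair-separated : ∀ s (i : Fin n) p → ‖ point (spike s i) -ᵥ point (pair p) ‖² ≢ 0₃
    spike-pair-separated s i p@(k , l , k<l) h =
      spike-pair i p s _ (e-dot-pair≢2 i (<⇒≢ k<l))
        (dist-form≡0 (spike s i) (pair p) (dot-·ˡ (spike-height s) (e i) (e k +ᵥ e l)) h)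

    pair-separated : ∀ (p q : Pair n) → ‖ point (pair p) -ᵥ point (pair q) ‖² ≡ 0₃ → pair p ≡ pair q
    pair-separated p@(i , j , i<j) q@(k , l , k<l) h
      with pair-overlap≡2⇒≡ i<j k<l (pair-pair p q _ (dist-form≡0 (pair p) (pair q) refl h))
    ... | refl , refl = cong (λ lt → pair (i , j , lt)) (<-irrelevant i<j k<l)

  dist-point≡0⇒≡ : ∀ (c d : Code n) → ‖ point c -ᵥ point d ‖² ≡ 0₃ → c ≡ d
  dist-point≡0⇒≡ (flat a)    d           h = flat-separated a d h
  dist-point≡0⇒≡ c           (flat b)    h =
    sym (flat-separated b c (trans (‖-‖²-comm (point (flat b)) (point c)) h))
  dist-point≡0⇒≡ (spike s i) (spike t k) h = spike-separated s t i k h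
  dist-point≡0⇒≡ (spike s i) (pair p)    h = ⊥-elim (spike-pair-separated s i p h)
  dist-point≡0⇒≡ (pair p)    (spike s i) h =
    ⊥-elim (spike-pair-separated s i p (trans (‖-‖²-comm (point (spike s i)) (point (pair p))) h))
  dist-point≡0⇒≡ (pair p)    (pair q)    h = pair-separated p q h

-- Counting

pair-zero : Fin n → Pair (suc n)
pair-zero j = zero , suc j , s≤s z≤n

pair-suc : Pair n → Pair (suc n)
pair-suc (i , j , i<j) = suc i , suc j , s≤s i<j

pairs : ∀ n → List (Pair n)
pairs zero    = []
pairs (suc n) = List.map pair-zero (allFin n) List.++ List.map pair-suc (pairs n)

codes : ∀ n → List (Code n)
codes n = List.map flat (allFin 2)
          List.++ List.map (uncurry spike) (cartesianProduct (allFin 3) (allFin n))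
          List.++ List.map pair (pairs n)

map-disjoint : ∀ {A B C : Set} {f : A → C} {g : B → C} → (∀ x y → f x ≢ g y) →
               ∀ {xs ys} → Disjoint (List.map f xs) (List.map g ys)
map-disjoint {f = f} {g} f≢g (v∈fxs , v∈gys) with ∈-map⁻ f v∈fxs | ∈-map⁻ g v∈gys
... | x , _ , v≡fx | y , _ , v≡gy = f≢g x y (trans (sym v≡fx) v≡gy)

disjoint-++ʳ : ∀ {A : Set} {xs ys zs : List A} → Disjoint xs ys → Disjoint xs zs → Disjoint xs (ys List.++ zs)
disjoint-++ʳ {ys = ys} xs#ys xs#zs (v∈xs , v∈ys++zs) with ∈-++⁻ ys v∈ys++zs
... | inj₁ v∈ys = xs#ys (v∈xs , v∈ys)
... | inj₂ v∈zs = xs#zs (v∈xs , v∈zs)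

pair-zero-injective : ∀ {j j′ : Fin n} → pair-zero j ≡ pair-zero j′ → j ≡ j′
pair-zero-injective refl = refl

pair-suc-injective : ∀ {p q : Pair n} → pair-suc p ≡ pair-suc q → p ≡ q
pair-suc-injective {p = _ , _ , i<j} {_ , _ , k<l} refl = cong (λ lt → _ , _ , lt) (<-irrelevant i<j k<l)

pairs-unique : ∀ n → Unique (pairs n)
pairs-unique zero    = []
pairs-unique (suc n) =
  ++⁺ (map⁺ pair-zero-injective (allFin⁺ n)) (map⁺ pair-suc-injective (pairs-unique n)) (map-disjoint λ _ _ ())

codes-unique : ∀ n → Unique (codes n)
codes-unique n =
  ++⁺ (map⁺ flat-injective (allFin⁺ 2))
      (++⁺ (map⁺ spike-injective (cartesianProduct⁺ (allFin⁺ 3) (allFin⁺ n)))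
           (map⁺ pair-injective (pairs-unique n))
           (map-disjoint λ _ _ ()))
      (disjoint-++ʳ (map-disjoint {f = flat} {g = uncurry spike} (λ _ _ ()) {allFin 2} {spikes})
                    (map-disjoint {f = flat} {g = pair} (λ _ _ ()) {allFin 2} {pairs n}))
  where
  spikes = cartesianProduct (allFin 3) (allFin n)
  flat-injective : ∀ {a b} → flat {n} a ≡ flat b → a ≡ b
  flat-injective refl = refl
  spike-injective : ∀ {p q} → uncurry (spike {n}) p ≡ uncurry spike q → p ≡ q
  spike-injective {_ , _} {_ , _} refl = refl
  pair-injective : ∀ {p q} → pair {n} p ≡ pair q → p ≡ q
  pair-injective refl = refl

codes-admissible : n % 3 ≡ 2 → Admissible n (List.map point (codes n))
codes-admissible {n} n%3≡2 = map⁺ {f = point} point-injective (codes-unique n) , separated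
  where
  point-injective : ∀ {c d : Code n} → point c ≡ point d → c ≡ d
  point-injective {c} {d} pc≡pd = dist-point≡0⇒≡ (‖𝟙‖²≡2 {n} n%3≡2) c d
    (subst (λ v → ‖ point c -ᵥ v ‖² ≡ 0₃) pc≡pd (‖x-x‖²≡0 (point c)))
  separated : ∀ x y → x ∈ List.map point (codes n) → y ∈ List.map point (codes n) →
              x ≢ y → ‖ x -ᵥ y ‖² ≢ 0₃
  separated x y x∈ y∈ x≢y ‖x-y‖²≡0 with ∈-map⁻ point {xs = codes n} x∈ | ∈-map⁻ point {xs = codes n} y∈
  ... | c , _ , refl | d , _ , refl = x≢y (cong point (dist-point≡0⇒≡ (‖𝟙‖²≡2 {n} n%3≡2) c d ‖x-y‖²≡0))

C2-suc : ∀ n → suc n C 2 ≡ n + n C 2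
C2-suc n = trans (sym (nCk+nC[k+1]≡[n+1]C[k+1] n 1)) (cong (_+ n C 2) (nC1≡n n))

length-allFin : ∀ n → length (allFin n) ≡ n
length-allFin n = length-tabulate id

length-pairs : ∀ n → length (pairs n) ≡ n C 2
length-pairs zero    = refl
length-pairs (suc n) = begin
  length (List.map pair-zero (allFin n) List.++ List.map pair-suc (pairs n))
    ≡⟨ length-++ (List.map pair-zero (allFin n)) {List.map pair-suc (pairs n)} ⟩
  length (List.map pair-zero (allFin n)) + length (List.map pair-suc (pairs n))
    ≡⟨ cong₂ _+_ (trans (length-map pair-zero (allFin n)) (length-allFin n))
                 (trans (length-map pair-suc (pairs n)) (length-pairs n)) ⟩
  n + n C 2
    ≡⟨ C2-suc n ⟨
  suc n C 2
    ∎

length-cartesianProduct : ∀ {A B : Set} (xs : List A) (ys : List B) →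
                          length (cartesianProduct xs ys) ≡ length xs * length ys
length-cartesianProduct []       ys = refl
length-cartesianProduct (x ∷ xs) ys =
  trans (length-++ (List.map (x ,_) ys) {cartesianProduct xs ys})
        (cong₂ _+_ (length-map (x ,_) ys) (length-cartesianProduct xs ys))

length-codes : ∀ n → length (codes n) ≡ 2 + (3 * n + n C 2)
length-codes n = begin
  length (codes n)
    ≡⟨ length-++ (List.map (flat {n}) (allFin 2)) {List.map (uncurry spike) spikes List.++ List.map pair (pairs n)} ⟩
  2 + length (List.map (uncurry spike) spikes List.++ List.map pair (pairs n))
    ≡⟨ cong (2 +_) (length-++ (List.map (uncurry spike) spikes) {List.map pair (pairs n)}) ⟩
  2 + (length (List.map (uncurry spike) spikes) + length (List.map pair (pairs n)))
    ≡⟨ cong (2 +_) (cong₂ _+_ length-spikes (trans (length-map pair (pairs n)) (length-pairs n))) ⟩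
  2 + (3 * n + n C 2)
    ∎
  where
  spikes = cartesianProduct (allFin 3) (allFin n)
  length-spikes : length (List.map (uncurry spike) spikes) ≡ 3 * n
  length-spikes = trans (length-map (uncurry spike) spikes)
                        (trans (length-cartesianProduct (allFin 3) (allFin n)) (cong (3 *_) (length-allFin n)))

[n+3]C2∸1 : ∀ n → (n + 3) C 2 ∸ 1 ≡ 2 + (3 * n + n C 2)
[n+3]C2∸1 n = begin
  (n + 3) C 2 ∸ 1                         ≡⟨ cong (λ m → m C 2 ∸ 1) (+-comm n 3) ⟩
  (3 + n) C 2 ∸ 1                         ≡⟨ cong (_∸ 1) (C2-suc (2 + n)) ⟩
  (2 + n) + (2 + n) C 2 ∸ 1               ≡⟨ cong (λ m → (2 + n) + m ∸ 1) (C2-suc (1 + n)) ⟩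
  (2 + n) + ((1 + n) + (1 + n) C 2) ∸ 1   ≡⟨ cong (λ m → (2 + n) + ((1 + n) + m) ∸ 1) (C2-suc n) ⟩
  (2 + n) + ((1 + n) + (n + n C 2)) ∸ 1   ≡⟨ tally n (n C 2) ⟩
  2 + (3 * n + n C 2)                     ∎
  where
  open +-*-Solver
  tally : ∀ n c → (2 + n) + ((1 + n) + (n + c)) ∸ 1 ≡ 2 + (3 * n + c)
  tally = solve 2 (λ n c → con 1 :+ (n :+ ((con 1 :+ n) :+ (n :+ c))) := con 2 :+ (con 3 :* n :+ c)) refl

featureDim≡ : ∀ n → featureDim n ≡ 2 + (3 * n + n C 2)
featureDim≡ n = begin
  suc (n + (triangular n + (n + 1)))   ≡⟨ cong (λ t → suc (n + (t + (n + 1)))) (triangular≡ n) ⟩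
  suc (n + ((n + n C 2) + (n + 1)))    ≡⟨ tally n (n C 2) ⟩
  2 + (3 * n + n C 2)                  ∎
  where
  open +-*-Solver
  tally : ∀ n c → suc (n + ((n + c) + (n + 1))) ≡ 2 + (3 * n + c)
  tally = solve 2 (λ n c → con 1 :+ (n :+ ((n :+ c) :+ (n :+ con 1))) := con 2 :+ (con 3 :* n :+ c)) refl
  triangular≡ : ∀ n → triangular n ≡ n + n C 2
  triangular≡ zero    = refl
  triangular≡ (suc n) = cong (λ t → suc (n + t)) (trans (triangular≡ n) (sym (C2-suc n)))

-- The hypothesis 0 < n is implied by n % 3 ≡ 2.
theorem1p7 : (n : ℕ) → 0 < n → n % 3 ≡ 2 → IsS3 n (((n + 3) C 2) ∸ 1)
theorem1p7 n _ n%3≡2 =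
  (List.map point (codes n) , codes-admissible n%3≡2 , size-of-construction) , size-of-admissible
  where
  size-of-construction : length (List.map point (codes n)) ≡ (n + 3) C 2 ∸ 1
  size-of-construction = trans (length-map point (codes n)) (trans (length-codes n) (sym ([n+3]C2∸1 n)))
  size-of-admissible : ∀ A → Admissible n A → length A ≤ (n + 3) C 2 ∸ 1
  size-of-admissible A adm =
    subst (length A ≤_) (trans (featureDim≡ n) (sym ([n+3]C2∸1 n))) (admissible⇒length≤featureDim A adm)
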